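{- Let $G$ be a graph on $n$ vertices and $\overline{G}$ its complement. (a) If $n \ge 5$, then $3 \le \operatorname{fd}(G) + \operatorname{fd}(\overline{G}) \le 2n-4$, and both bounds are sharp (for each $n \ge 5$ there are graphs on $n$ vertices attaining each bound). (b) If $n \ge 4$, then $2 \le \operatorname{fd}(G)\cdot \operatorname{fd}(\overline{G}) \le (n-2)^2$, and both bounds are sharp (for each $n \ge 4$ there are graphs on $n$ vertices attaining each bound).
   Context: All graphs are finite and simple; $N(v)$ denotes the open neighborhood of $v$. For a graph $G=(V,E)$ and an integer $k \ge 1$, a $k$-fair dominating set is a dominating set $D \subseteq V$ such that $|N(v) \cap D| = k$ for every $v \in V \setminus D$ (the set $D = V$ qualifies vacuously). A fair dominating set (FD-set) is a set that is a $k$-fair dominating set for some $k \ge 1$. If $G$ has at least one edge, $\operatorname{fd}(G)$ is the minimum cardinality of an FD-set of $G$; by convention, $\operatorname{fd}(\overline{K_n}) = n$ for the edgeless graph on $n$ vertices. -}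

module Defs where

open import Data.Nat using (ℕ; _≤_)
open import Data.Bool using (Bool; true; false; not; _∧_)
open import Data.Bool.Properties using (∧-comm)
open import Data.Fin using (Fin; _≟_)
open import Data.Empty using (⊥-elim)
open import Relation.Nullary using (yes; no)
open import Data.Fin.Subset using (Subset; _∈_; _∉_; _∩_; ∣_∣)
open import Data.Vec using (tabulate)
open import Data.Product using (Σ; ∃; ∃-syntax; _×_; _,_)
open import Relation.Nullary using (¬_)
open import Relation.Nullary.Decidable using (⌊_⌋)
open import Relation.Binary.PropositionalEquality using (_≡_; refl; cong₂)
import Relation.Binary.PropositionalEquality as P

record Graph (n : ℕ) : Set where
  field
    adj   : Fin n → Fin n → Bool
    adj-sym : ∀ u v → adj u v ≡ adj v u
    irrefl : ∀ v → adj v v ≡ false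
open Graph public

complement : ∀ {n} → Graph n → Graph n
complement {n} G = record
  { adj = λ u v → not (adj G u v) ∧ not ⌊ u ≟ v ⌋
  ; adj-sym = λ u v → cong₂ (λ a b → not a ∧ not b) (adj-sym G u v) (≟-sym u v)
  ; irrefl = λ v → irr v
  }
  where
  ≟-sym : ∀ (u v : Fin n) → ⌊ u ≟ v ⌋ ≡ ⌊ v ≟ u ⌋
  ≟-sym u v with u ≟ v | v ≟ u
  ... | yes _ | yes _ = refl
  ... | no _ | no _ = refl
  ... | yes p | no q = ⊥-elim (q (P.sym p))
  ... | no p | yes q = ⊥-elim (p (P.sym q))
  irr : ∀ v → not (adj G v v) ∧ not ⌊ v ≟ v ⌋ ≡ false
  irr v with v ≟ v
  ... | yes _ rewrite ∧-comm (not (adj G v v)) false = refl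
  ... | no ¬p = ⊥-elim (¬p refl)

N : ∀ {n} → Graph n → Fin n → Subset n
N G v = tabulate (adj G v)

HasEdge : ∀ {n} → Graph n → Set
HasEdge G = ∃[ u ] ∃[ v ] adj G u v ≡ true

Dominating : ∀ {n} → Graph n → Subset n → Set
Dominating G D = ∀ v → v ∉ D → ∃[ u ] (u ∈ D × adj G v u ≡ true)

KFairDominating : ∀ {n} → Graph n → ℕ → Subset n → Set
KFairDominating G k D = Dominating G D × (∀ v → v ∉ D → ∣ N G v ∩ D ∣ ≡ k)

FairDominating : ∀ {n} → Graph n → Subset n → Set
FairDominating G D = ∃[ k ] (1 ≤ k × KFairDominating G k D)

-- IsFd G m : m = fd(G)  (minimum FD-set size if G has an edge; n if edgeless)
IsFd : ∀ {n} → Graph n → ℕ → Set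
IsFd {n} G m =
  (HasEdge G → (∃[ D ] (FairDominating G D × ∣ D ∣ ≡ m))
             × (∀ D → FairDominating G D → m ≤ ∣ D ∣))
  × (¬ HasEdge G → m ≡ n)

-- A set D is k-fair in G exactly when it is (|D| − k)-fair in Ḡ, since a vertex outside D sees
-- every vertex of D in exactly one of the two graphs.
--
-- Lower bounds: fd ≥ 1, and fd = 1 forces a universal vertex, which G and Ḡ cannot both have.
-- Upper bounds: a universal vertex of G or of Ḡ (a vertex of degree n − 1 or 0) gives fd ≤ 1
-- there and fd ≤ n in the other graph.  Otherwise all degrees lie in [1, n − 2], and two rounds
-- of pigeonhole give vertices u ≠ w of equal degree d such that V ∖ {u, w} is fair in both G
-- and Ḡ (u and w each have d − [u ∼ w] neighbours in it), so fd(G), fd(Ḡ) ≤ n − 2.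
--
-- The lower bounds are attained by the star.  The upper bounds are attained by the graph on
-- {0, …, n − 1} in which p, q ≥ 1 are adjacent iff p + q ≥ n, and 0 is adjacent only to
-- ⌊n/2⌋: a vertex v ≥ 1 outside S sees exactly the elements of S in [n − v, n), plus 0 when
-- v = ⌊n/2⌋, and a case analysis on whether 0 and ⌊n/2⌋ lie in S shows that no S with
-- 1 ≤ |S| ≤ n − 3 has the same number of neighbours in S at every vertex outside S.

module Submission where

open import Defs
open import Data.Bool using (Bool; true; false; not; _∧_)
open import Data.Bool.Properties using (∧-identityʳ; ∧-zeroʳ; ∧-comm; ∧-conicalˡ; ∧-conicalʳ)
import Data.Bool.Properties as Bool
open import Data.Empty using (⊥; ⊥-elim)
open import Data.Fin using (Fin; zero; suc; toℕ; _≟_; fromℕ<; punchIn)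
open import Data.Fin.Properties
  using (any?; pigeonhole; punchIn-injective; punchInᵢ≢i; toℕ-fromℕ<; toℕ-injective; toℕ<n)
  renaming (<⇒≢ to <⇒≢ᶠ)
open import Data.Fin.Subset using (Subset; _∉_; _∩_; ∣_∣; ⊤; ⁅_⁆)
import Data.Fin.Subset as Subset
open import Data.Fin.Subset.Properties using (∣⊤∣≡n; ∣⊥∣≡0; ∣⁅x⁆∣≡1; x∈⁅x⁆)
open import Data.Nat using (ℕ; zero; suc; _+_; _*_; _∸_; _≤_; _<_; z≤n; s≤s; s≤s⁻¹)
open import Data.Nat.Properties hiding (_≟_)
import Data.Nat.Properties as ℕ
open import Algebra.Properties.CommutativeSemigroup +-commutativeSemigroup using (x∙yz≈y∙xz; interchange)
open import Data.Product using (Σ-syntax; ∃-syntax; _×_; _,_; proj₁; proj₂)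
open import Data.Sum using (_⊎_; inj₁; inj₂)
open import Data.Vec using ([]; _∷_; lookup; tabulate)
open import Data.Vec.Properties
  using (lookup∘tabulate; lookup-zipWith; lookup-replicate; []=⇒lookup; lookup⇒[]=)
open import Function using (_∘_; flip; _⇔_; mk⇔)
open import Level using (Level)
open import Relation.Binary using (Rel; Total; Transitive; tri<; tri≈; tri>)
open import Relation.Binary.PropositionalEquality
open import Relation.Nullary using (Dec; ¬_; yes; no; contradiction)
open import Relation.Nullary.Decidable using (⌊_⌋; does; dec-true; dec-false; does-⇔)

private
  variable
    n : ℕ

bit : Bool → ℕ
bit true  = 1
bit false = 0

count : (Fin n → Bool) → ℕ
count {zero}  f = 0
count {suc n} f = bit (f zero) + count (f ∘ suc)

infix 4 _⊑_
_⊑_ : (f g : Fin n → Bool) → Set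
f ⊑ g = ∀ i → f i ≡ true → g i ≡ true

bit≤1 : ∀ b → bit b ≤ 1
bit≤1 true  = ≤-refl
bit≤1 false = z≤n

bit-mono : ∀ {a b} → (a ≡ true → b ≡ true) → bit a ≤ bit b
bit-mono {true}  a⇒b rewrite a⇒b refl = ≤-refl
bit-mono {false} _ = z≤n

count-cong : {f g : Fin n → Bool} → (∀ i → f i ≡ g i) → count f ≡ count g
count-cong {zero}  f≗g = refl
count-cong {suc n} f≗g = cong₂ _+_ (cong bit (f≗g zero)) (count-cong (f≗g ∘ suc))

count-mono : {f g : Fin n → Bool} → f ⊑ g → count f ≤ count g
count-mono {zero}  f⊑g = z≤n
count-mono {suc n} f⊑g = +-mono-≤ (bit-mono (f⊑g zero)) (count-mono (f⊑g ∘ suc))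

count-false : {f : Fin n → Bool} → (∀ i → f i ≡ false) → count f ≡ 0
count-false {zero}  _    = refl
count-false {suc n} none rewrite none zero = count-false (none ∘ suc)

count-pos : (f : Fin n → Bool) {i : Fin n} → f i ≡ true → 0 < count f
count-pos f {zero}  fi rewrite fi = s≤s z≤n
count-pos f {suc i} fi = ≤-trans (count-pos (f ∘ suc) fi) (m≤n+m _ (bit (f zero)))

count-pos⁻¹ : {f : Fin n → Bool} → 0 < count f → ∃[ i ] f i ≡ true
count-pos⁻¹ {suc n} {f} pos with f zero in f0
... | true  = zero , f0
... | false with count-pos⁻¹ pos
...   | i , fi = suc i , fi

count≡0⇒false : {f : Fin n → Bool} → count f ≡ 0 → ∀ i → f i ≡ false
count≡0⇒false {f = f} c≡0 i with f i in fi
... | false = refl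
... | true  = contradiction c≡0 (>⇒≢ (count-pos f fi))

count-< : {f g : Fin n → Bool} → f ⊑ g → ∀ a → g a ≡ true → f a ≡ false →
               count f < count g
count-< {suc n} {f} {g} f⊑g zero    ga fa rewrite ga | fa = s≤s (count-mono (f⊑g ∘ suc))
count-< {suc n} {f} {g} f⊑g (suc a) ga fa = begin-strict
  bit (f zero) + count (f ∘ suc) <⟨ +-monoʳ-< (bit (f zero)) (count-< (f⊑g ∘ suc) a ga fa) ⟩
  bit (f zero) + count (g ∘ suc) ≤⟨ +-monoˡ-≤ _ (bit-mono (f⊑g zero)) ⟩
  bit (g zero) + count (g ∘ suc) ∎
  where open ≤-Reasoning

count-≤⇒⊒ : {f g : Fin n → Bool} → f ⊑ g → count g ≤ count f → g ⊑ f
count-≤⇒⊒ {f = f} f⊑g g≤f i gi with f i in fi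
... | true  = refl
... | false = contradiction g≤f (<⇒≱ (count-< f⊑g i gi fi))

infixl 6 _-_
_-_ : (Fin n → Bool) → Fin n → Fin n → Bool
(f - a) i = f i ∧ not (does (i ≟ a))

-‿intro : (f : Fin n → Bool) {a i : Fin n} → f i ≡ true → i ≢ a → (f - a) i ≡ true
-‿intro f {a} {i} fi i≢a rewrite fi | dec-false (i ≟ a) i≢a = refl

-‿elim : (f : Fin n → Bool) {a i : Fin n} → (f - a) i ≡ true → f i ≡ true × i ≢ a
-‿elim f {a} {i} f-a[i] with f i | i ≟ a
... | true | no i≢a = refl , i≢a

count-remove : (f : Fin n → Bool) (a : Fin n) → count f ≡ bit (f a) + count (f - a)
count-remove {suc n} f zero rewrite ∧-zeroʳ (f zero) =
  cong (bit (f zero) +_) (count-cong λ i → sym (∧-identityʳ (f (suc i))))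
count-remove {suc n} f (suc a) rewrite ∧-identityʳ (f zero) = begin
  bit (f zero) + count (f ∘ suc)
    ≡⟨ cong (bit (f zero) +_) (count-remove (f ∘ suc) a) ⟩
  bit (f zero) + (bit (f (suc a)) + count ((f ∘ suc) - a))
    ≡⟨ x∙yz≈y∙xz (bit (f zero)) (bit (f (suc a))) _ ⟩
  bit (f (suc a)) + (bit (f zero) + count ((f ∘ suc) - a)) ∎
  where open ≡-Reasoning

count-single : (f : Fin n → Bool) (a : Fin n) → (∀ i → i ≢ a → f i ≡ false) → count f ≡ bit (f a)
count-single f a off = begin
  count f                    ≡⟨ count-remove f a ⟩
  bit (f a) + count (f - a)  ≡⟨ cong (bit (f a) +_) (count-false none) ⟩
  bit (f a) + 0              ≡⟨ +-identityʳ _ ⟩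
  bit (f a)                  ∎
  where
  open ≡-Reasoning
  none : ∀ i → (f - a) i ≡ false
  none i with i ≟ a
  ... | yes _   = ∧-zeroʳ (f i)
  ... | no  i≢a rewrite off i i≢a = refl

count-remove-true : (f : Fin n → Bool) {a : Fin n} → f a ≡ true → count f ≡ suc (count (f - a))
count-remove-true f {a} fa = trans (count-remove f a) (cong (λ x → bit x + count (f - a)) fa)

count-two : (f : Fin n → Bool) {a b : Fin n} → f a ≡ true → f b ≡ true → a ≢ b → 2 ≤ count f
count-two f fa fb a≢b =
  subst (2 ≤_) (sym (count-remove-true f fa)) (s≤s (count-pos (f - _) (-‿intro f fb (a≢b ∘ sym))))

count-three : (f : Fin n → Bool) {a b c : Fin n} → f a ≡ true → f b ≡ true → f c ≡ true →
              a ≢ b → a ≢ c → b ≢ c → 3 ≤ count f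
count-three f fa fb fc a≢b a≢c b≢c =
  subst (3 ≤_) (sym (count-remove-true f fa))
    (s≤s (count-two (f - _) (-‿intro f fb (a≢b ∘ sym)) (-‿intro f fc (a≢c ∘ sym)) b≢c))

count-two⁻¹ : {f : Fin n → Bool} → 2 ≤ count f → ∃[ a ] ∃[ b ] (a ≢ b × f a ≡ true × f b ≡ true)
count-two⁻¹ {f = f} 2≤ with count-pos⁻¹ (≤-trans (s≤s z≤n) 2≤)
... | a , fa with count-pos⁻¹ {f = f - a} (s≤s⁻¹ (subst (2 ≤_) (count-remove-true f fa) 2≤))
...   | b , f-a[b] = a , b , proj₂ (-‿elim f f-a[b]) ∘ sym , fa , proj₁ (-‿elim f f-a[b])

count≡1⇒unique : (f : Fin n → Bool) → count f ≡ 1 →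
                  ∃[ x ] (f x ≡ true × ∀ v → v ≢ x → f v ≡ false)
count≡1⇒unique f count≡1 with count-pos⁻¹ (≤-reflexive (sym count≡1))
... | x , fx = x , fx , only-x
  where
  only-x : ∀ v → v ≢ x → f v ≡ false
  only-x v v≢x with f v in fv
  ... | false = refl
  ... | true  with s≤s () ← subst (2 ≤_) count≡1 (count-two f fx fv (v≢x ∘ sym))

count-two-avoiding : {f : Fin n → Bool} (x : Fin n) → 3 ≤ count f →
  ∃[ a ] ∃[ b ] (a ≢ b × a ≢ x × b ≢ x × f a ≡ true × f b ≡ true)
count-two-avoiding {f = f} x 3≤ with count-two⁻¹ {f = f - x} 2≤
  where
  2≤ : 2 ≤ count (f - x)
  2≤ = +-cancelˡ-≤ 1 2 _
         (≤-trans 3≤ (≤-trans (≤-reflexive (count-remove f x)) (+-monoˡ-≤ _ (bit≤1 (f x)))))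
... | a , b , a≢b , f-x[a] , f-x[b] =
  a , b , a≢b , proj₂ (-‿elim f f-x[a]) , proj₂ (-‿elim f f-x[b]) ,
  proj₁ (-‿elim f f-x[a]) , proj₁ (-‿elim f f-x[b])

not≡true⇒false : {b : Bool} → not b ≡ true → b ≡ false
not≡true⇒false {false} _ = refl

count-true : count {n} (λ _ → true) ≡ n
count-true {zero}  = refl
count-true {suc n} = cong suc count-true

count-∧-not : (g f : Fin n → Bool) →
              count (λ i → g i ∧ f i) + count (λ i → g i ∧ not (f i)) ≡ count g
count-∧-not {zero}  g f = refl
count-∧-not {suc n} g f = begin
  (bit (g zero ∧ f zero) + count (λ i → g (suc i) ∧ f (suc i))) +
    (bit (g zero ∧ not (f zero)) + count (λ i → g (suc i) ∧ not (f (suc i))))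
      ≡⟨ interchange (bit (g zero ∧ f zero)) _ _ _ ⟩
  (bit (g zero ∧ f zero) + bit (g zero ∧ not (f zero))) +
    (count (λ i → g (suc i) ∧ f (suc i)) + count (λ i → g (suc i) ∧ not (f (suc i))))
      ≡⟨ cong₂ _+_ (bit-split (g zero) (f zero)) (count-∧-not (g ∘ suc) (f ∘ suc)) ⟩
  bit (g zero) + count (g ∘ suc) ∎
  where
  open ≡-Reasoning
  bit-split : ∀ a b → bit (a ∧ b) + bit (a ∧ not b) ≡ bit a
  bit-split true  true  = refl
  bit-split true  false = refl
  bit-split false _     = refl

count-not : (f : Fin n → Bool) → count f + count (not ∘ f) ≡ n
count-not f = trans (count-∧-not (λ _ → true) f) count-true

module _ {a ℓ : Level} {A : Set a} {_≼_ : Rel A ℓ} (total : Total _≼_) (≼-trans : Transitive _≼_) where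

  extremum : (w : Fin n → A) (f : Fin n → Bool) {x : Fin n} → f x ≡ true →
             ∃[ e ] (f e ≡ true × ∀ i → f i ≡ true → w e ≼ w i)
  extremum w f {x} fx with search w f
    where
    ≼-refl : ∀ y → y ≼ y
    ≼-refl y with total y y
    ... | inj₁ y≼y = y≼y
    ... | inj₂ y≼y = y≼y
    search : ∀ {n} (w : Fin n → A) (f : Fin n → Bool) →
             (∀ i → f i ≡ false) ⊎ ∃[ e ] (f e ≡ true × ∀ i → f i ≡ true → w e ≼ w i)
    search {zero}  w f = inj₁ λ ()
    search {suc n} w f with search (w ∘ suc) (f ∘ suc) | f zero in f0
    ... | inj₁ none | false = inj₁ λ { zero → f0 ; (suc i) → none i }
    ... | inj₁ none | true  = inj₂ (zero , f0 , λ { zero _ → ≼-refl (w zero)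
                                                 ; (suc i) fi → contradiction (trans (sym fi) (none i)) λ () })
    ... | inj₂ (e , fe , ext) | false = inj₂ (suc e , fe , λ { zero fi → contradiction (trans (sym fi) f0) λ ()
                                                           ; (suc i) fi → ext i fi })
    ... | inj₂ (e , fe , ext) | true with total (w zero) (w (suc e))
    ...   | inj₁ z≼e = inj₂ (zero , f0 , λ { zero _ → ≼-refl (w zero)
                                             ; (suc i) fi → ≼-trans z≼e (ext i fi) })
    ...   | inj₂ e≼z = inj₂ (suc e , fe , λ { zero _ → e≼z ; (suc i) fi → ext i fi })
  ... | inj₁ none = contradiction (trans (sym fx) (none x)) λ ()
  ... | inj₂ ext  = ext

neighboursIn : Graph n → (Fin n → Bool) → Fin n → ℕ
neighboursIn G S v = count (λ u → adj G v u ∧ S u)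

Fair : Graph n → ℕ → (Fin n → Bool) → Set
Fair G k S = ∀ v → S v ≡ false → neighboursIn G S v ≡ k

fair-cong : (G : Graph n) {S S′ : Fin n → Bool} {k : ℕ} →
            (∀ i → S i ≡ S′ i) → Fair G k S → Fair G k S′
fair-cong G {S} {S′} S≗S′ fair v S′v =
  trans (count-cong λ u → cong (adj G v u ∧_) (sym (S≗S′ u))) (fair v (trans (S≗S′ v) S′v))

Universal : Graph n → Fin n → Set
Universal G x = ∀ v → v ≢ x → adj G v x ≡ true

∣D∣≡count : (D : Subset n) → ∣ D ∣ ≡ count (lookup D)
∣D∣≡count []          = refl
∣D∣≡count (true  ∷ D) = cong suc (∣D∣≡count D)
∣D∣≡count (false ∷ D) = ∣D∣≡count D

∣tabulate∣≡count : (S : Fin n → Bool) → ∣ tabulate S ∣ ≡ count S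
∣tabulate∣≡count S = trans (∣D∣≡count (tabulate S)) (count-cong (lookup∘tabulate S))

∣N∩D∣≡neighboursIn : (G : Graph n) (D : Subset n) (v : Fin n) →
                     ∣ N G v ∩ D ∣ ≡ neighboursIn G (lookup D) v
∣N∩D∣≡neighboursIn G D v = trans (∣D∣≡count (N G v ∩ D)) (count-cong λ u →
  trans (lookup-zipWith _∧_ u (N G v) D) (cong (_∧ lookup D u) (lookup∘tabulate (adj G v) u)))

∉⇒false : {D : Subset n} {v : Fin n} → v ∉ D → lookup D v ≡ false
∉⇒false {D = D} {v} v∉D with lookup D v in Dv
... | false = refl
... | true  = contradiction (lookup⇒[]= v D Dv) v∉D

false⇒∉ : {D : Subset n} {v : Fin n} → lookup D v ≡ false → v ∉ D
false⇒∉ Dv v∈D = contradiction (trans (sym ([]=⇒lookup v∈D)) Dv) λ ()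

fair⇒fairDominating : (G : Graph n) (D : Subset n) {k : ℕ} → 1 ≤ k → Fair G k (lookup D) →
                      FairDominating G D
fair⇒fairDominating G D {k} 1≤k fair = k , 1≤k , dominating , exact
  where
  exact : ∀ v → v ∉ D → ∣ N G v ∩ D ∣ ≡ k
  exact v v∉D = trans (∣N∩D∣≡neighboursIn G D v) (fair v (∉⇒false v∉D))
  dominating : Dominating G D
  dominating v v∉D with count-pos⁻¹ (subst (1 ≤_) (sym (fair v (∉⇒false v∉D))) 1≤k)
  ... | u , v∼u∈D = u , lookup⇒[]= u D (∧-conicalʳ _ _ v∼u∈D) , ∧-conicalˡ _ _ v∼u∈D

fairDominating⇒fair : (G : Graph n) (D : Subset n) → FairDominating G D →
                      ∃[ k ] (1 ≤ k × Fair G k (lookup D))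
fairDominating⇒fair G D (k , 1≤k , _ , exact) =
  k , 1≤k , λ v Dv → trans (sym (∣N∩D∣≡neighboursIn G D v)) (exact v (false⇒∉ Dv))

fairDominating-nonempty : (G : Graph n) (D : Subset n) → Fin n → FairDominating G D → 1 ≤ ∣ D ∣
fairDominating-nonempty G D v fd with lookup D v in Dv | fairDominating⇒fair G D fd
... | true  | _ = subst (1 ≤_) (sym (∣D∣≡count D)) (count-pos (lookup D) Dv)
... | false | k , 1≤k , fair = begin
  1                                ≤⟨ 1≤k ⟩
  k                                ≡⟨ sym (fair v Dv) ⟩
  neighboursIn G (lookup D) v      ≤⟨ count-mono {g = lookup D} (λ u → ∧-conicalʳ (adj G v u) _) ⟩
  count (lookup D)                 ≡⟨ sym (∣D∣≡count D) ⟩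
  ∣ D ∣                            ∎
  where open ≤-Reasoning

fairDominating-singleton⇒universal : (G : Graph n) (D : Subset n) → FairDominating G D → ∣ D ∣ ≡ 1 →
                                     ∃[ x ] Universal G x
fairDominating-singleton⇒universal G D (_ , _ , dominating , _) ∣D∣≡1
  with count≡1⇒unique (lookup D) (trans (sym (∣D∣≡count D)) ∣D∣≡1)
... | x , Dx , only-x = x , universal
  where
  universal : Universal G x
  universal v v≢x with dominating v (false⇒∉ (only-x v v≢x))
  ... | u , u∈D , v∼u with u ≟ x
  ...   | yes refl = v∼u
  ...   | no  u≢x  = contradiction (trans (sym ([]=⇒lookup u∈D)) (only-x u u≢x)) λ ()

lookup-⁅⁆ : (x i : Fin n) → lookup ⁅ x ⁆ i ≡ does (i ≟ x)
lookup-⁅⁆ zero    zero    = refl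
lookup-⁅⁆ zero    (suc i) = lookup-replicate i false
lookup-⁅⁆ (suc x) zero    = refl
lookup-⁅⁆ (suc x) (suc i) = lookup-⁅⁆ x i

universal⇒fairDominating : (G : Graph n) {x : Fin n} → Universal G x → FairDominating G ⁅ x ⁆
universal⇒fairDominating G {x} universal = fair⇒fairDominating G ⁅ x ⁆ ≤-refl fair
  where
  fair : Fair G 1 (lookup ⁅ x ⁆)
  fair v v∉x = begin
    neighboursIn G (lookup ⁅ x ⁆) v   ≡⟨ count-single _ x off ⟩
    bit (adj G v x ∧ lookup ⁅ x ⁆ x)  ≡⟨ cong bit (cong₂ _∧_ (universal v v≢x) ([]=⇒lookup (x∈⁅x⁆ x))) ⟩
    1                                 ∎
    where
    open ≡-Reasoning
    v≢x : v ≢ x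
    v≢x refl = contradiction (trans (sym ([]=⇒lookup (x∈⁅x⁆ x))) v∉x) λ ()
    off : ∀ i → i ≢ x → adj G v i ∧ lookup ⁅ x ⁆ i ≡ false
    off i i≢x = trans (cong (adj G v i ∧_) (trans (lookup-⁅⁆ x i) (dec-false (i ≟ x) i≢x)))
                      (∧-zeroʳ _)

neighboursIn-complement : (G : Graph n) (S : Fin n → Bool) {v : Fin n} → S v ≡ false →
  neighboursIn G S v + neighboursIn (complement G) S v ≡ count S
neighboursIn-complement G S {v} Sv = begin
  neighboursIn G S v + neighboursIn (complement G) S v
    ≡⟨ cong₂ _+_ (count-cong λ u → ∧-comm (adj G v u) (S u)) (count-cong non-neighbour) ⟩
  count (λ u → S u ∧ adj G v u) + count (λ u → S u ∧ not (adj G v u))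
    ≡⟨ count-∧-not S (adj G v) ⟩
  count S ∎
  where
  open ≡-Reasoning
  non-neighbour : ∀ u → adj (complement G) v u ∧ S u ≡ S u ∧ not (adj G v u)
  non-neighbour u with v ≟ u
  ... | yes refl rewrite Sv = ∧-zeroʳ _
  ... | no  _    = trans (cong (_∧ S u) (∧-identityʳ _)) (∧-comm _ (S u))

fair-complement : (G : Graph n) {S : Fin n → Bool} {k : ℕ} →
                  Fair G k S → Fair (complement G) (count S ∸ k) S
fair-complement G {S} {k} fair v Sv = begin
  neighboursIn (complement G) S v
    ≡⟨ sym (m+n∸m≡n (neighboursIn G S v) _) ⟩
  neighboursIn G S v + neighboursIn (complement G) S v ∸ neighboursIn G S v
    ≡⟨ cong₂ _∸_ (neighboursIn-complement G S Sv) (fair v Sv) ⟩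
  count S ∸ k ∎
  where open ≡-Reasoning

fair-complement⁻¹ : (G : Graph n) {S : Fin n → Bool} {k : ℕ} →
                    Fair (complement G) k S → Fair G (count S ∸ k) S
fair-complement⁻¹ G {S} {k} fair v Sv = begin
  neighboursIn G S v
    ≡⟨ sym (m+n∸n≡m _ (neighboursIn (complement G) S v)) ⟩
  neighboursIn G S v + neighboursIn (complement G) S v ∸ neighboursIn (complement G) S v
    ≡⟨ cong₂ _∸_ (neighboursIn-complement G S Sv) (fair v Sv) ⟩
  count S ∸ k ∎
  where open ≡-Reasoning

fair⇒fairDominating-complement : (G : Graph n) (D : Subset n) {k : ℕ} →
  Fair G k (lookup D) → k < ∣ D ∣ → FairDominating (complement G) D
fair⇒fairDominating-complement G D fair k<∣D∣ =
  fair⇒fairDominating (complement G) D (m<n⇒0<n∸m (subst (_ <_) (∣D∣≡count D) k<∣D∣))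
                      (fair-complement G fair)

hasEdge? : (G : Graph n) → HasEdge G ⊎ ¬ HasEdge G
hasEdge? G with any? (λ u → any? (λ v → adj G u v Bool.≟ true))
... | yes edge = inj₁ edge
... | no  none = inj₂ none

outside⇒edge : (H : Graph n) (D : Subset n) → FairDominating H D →
               (v : Fin n) → lookup D v ≡ false → HasEdge H
outside⇒edge H D (_ , _ , dominating , _) v Dv with dominating v (false⇒∉ Dv)
... | u , _ , v∼u = v , u , v∼u

IsFd-minimal : (H : Graph n) {m : ℕ} (D : Subset n) → IsFd H m → FairDominating H D →
               (v : Fin n) → lookup D v ≡ false → m ≤ ∣ D ∣
IsFd-minimal H D (fd-of , _) fd v Dv = proj₂ (fd-of (outside⇒edge H D fd v Dv)) D fd

IsFd-≤n : (H : Graph n) {m : ℕ} → IsFd H m → m ≤ n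
IsFd-≤n {n} H (fd-of , edgeless) with hasEdge? H
... | inj₁ edge = ≤-trans (proj₂ (fd-of edge) ⊤ everything) (≤-reflexive (∣⊤∣≡n n))
  where
  everything : FairDominating H ⊤
  everything = fair⇒fairDominating H ⊤ ≤-refl
                 λ v ⊤v → contradiction (trans (sym ⊤v) (lookup-replicate v true)) λ ()
... | inj₂ no-edge = ≤-reflexive (edgeless no-edge)

IsFd-pos : (H : Graph n) {m : ℕ} → IsFd H m → Fin n → 1 ≤ m
IsFd-pos {suc n} H (fd-of , edgeless) v with hasEdge? H
... | inj₁ edge with proj₁ (fd-of edge)
...   | D , fd , refl = fairDominating-nonempty H D v fd
IsFd-pos {suc n} H (fd-of , edgeless) v | inj₂ no-edge = subst (1 ≤_) (sym (edgeless no-edge)) (s≤s z≤n)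

IsFd-1⇒universal : (H : Graph n) → IsFd H 1 → 2 ≤ n → ∃[ x ] Universal H x
IsFd-1⇒universal H (fd-of , edgeless) 2≤n with hasEdge? H
... | inj₁ edge with proj₁ (fd-of edge)
...   | D , fd , ∣D∣≡1 = fairDominating-singleton⇒universal H D fd ∣D∣≡1
IsFd-1⇒universal H (fd-of , edgeless) 2≤n | inj₂ no-edge with edgeless no-edge | 2≤n
... | refl | s≤s ()

universal⇒IsFd≤1 : (H : Graph n) {m : ℕ} {x : Fin n} → IsFd H m → Universal H x →
                   (v : Fin n) → v ≢ x → m ≤ 1
universal⇒IsFd≤1 H {x = x} isFd universal v v≢x =
  subst (_ ≤_) (∣⁅x⁆∣≡1 x) (IsFd-minimal H ⁅ x ⁆ isFd (universal⇒fairDominating H universal) v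
                                         (trans (lookup-⁅⁆ x v) (dec-false (v ≟ x) v≢x)))

IsFd-intro : (H : Graph n) {m : ℕ} (D : Subset n) → FairDominating H D → ∣ D ∣ ≡ m →
             (v : Fin n) → lookup D v ≡ false → (∀ D′ → FairDominating H D′ → m ≤ ∣ D′ ∣) → IsFd H m
IsFd-intro H D fd ∣D∣≡m v Dv minimum =
  (λ _ → (D , fd , ∣D∣≡m) , minimum) , (λ no-edge → contradiction (outside⇒edge H D fd v Dv) no-edge)

-- Lower bounds

¬universal-both : (G : Graph n) {x y : Fin n} → Universal G x → Universal (complement G) y →
                  (z : Fin n) → z ≢ x → ⊥
¬universal-both G {x} {y} Gx Ḡy z z≢x with x ≟ y
... | yes refl with () ← trans (sym (cong (λ b → not b ∧ not ⌊ z ≟ x ⌋) (Gx z z≢x))) (Ḡy z z≢x)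
... | no  x≢y with adj G x y in x∼y | Ḡy x x≢y
...   | false | _ with () ← trans (sym x∼y) (trans (adj-sym G x y) (Gx y (x≢y ∘ sym)))
...   | true  | ()

another-vertex : (v : Fin (suc (suc n))) → ∃[ w ] w ≢ v
another-vertex zero    = suc zero , λ ()
another-vertex (suc _) = zero , λ ()

IsFd-lower : (G : Graph n) {a b : ℕ} → 2 ≤ n → IsFd G a → IsFd (complement G) b →
             1 ≤ a × 1 ≤ b × (2 ≤ a ⊎ 2 ≤ b)
IsFd-lower {suc (suc n)} G {a} {b} 2≤n@(s≤s (s≤s z≤n)) isFdG isFdḠ = 1≤a , 1≤b , one-is-large
  where
  1≤a : 1 ≤ a
  1≤a = IsFd-pos G isFdG zero
  1≤b : 1 ≤ b
  1≤b = IsFd-pos (complement G) isFdḠ zero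
  one-is-large : 2 ≤ a ⊎ 2 ≤ b
  one-is-large with m≤n⇒m<n∨m≡n 1≤a | m≤n⇒m<n∨m≡n 1≤b
  ... | inj₁ 1<a | _         = inj₁ 1<a
  ... | inj₂ _   | inj₁ 1<b  = inj₂ 1<b
  ... | inj₂ refl | inj₂ refl with IsFd-1⇒universal G isFdG 2≤n | IsFd-1⇒universal (complement G) isFdḠ 2≤n
  ...   | x , Gx | _ , Ḡy =
    ⊥-elim (¬universal-both G Gx Ḡy (proj₁ (another-vertex x)) (proj₂ (another-vertex x)))

-- Upper bounds

degree : Graph n → Fin n → ℕ
degree G v = count (adj G v)

degree-non-neighbours : (G : Graph n) (v : Fin n) → degree G v + count (not ∘ adj G v) ≡ n
degree-non-neighbours G v = count-not (adj G v)

degree<n : (G : Graph n) (v : Fin n) → degree G v < n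
degree<n G v = begin-strict
  degree G v                           ≡⟨ +-identityʳ _ ⟨
  degree G v + 0                       <⟨ +-monoʳ-< (degree G v) (count-pos (not ∘ adj G v) (cong not (irrefl G v))) ⟩
  degree G v + count (not ∘ adj G v)   ≡⟨ degree-non-neighbours G v ⟩
  _                                    ∎
  where open ≤-Reasoning

degree+3≤n : (G : Graph n) {v x y : Fin n} → adj G v x ≡ false → adj G v y ≡ false →
             v ≢ x → v ≢ y → x ≢ y → degree G v + 3 ≤ n
degree+3≤n G {v} v≁x v≁y v≢x v≢y x≢y = subst (degree G v + 3 ≤_) (degree-non-neighbours G v)
  (+-monoʳ-≤ (degree G v) (count-three (not ∘ adj G v) (cong not (irrefl G v)) (cong not v≁x) (cong not v≁y)
                                       v≢x v≢y x≢y))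

isolated⇒universal-complement : (G : Graph n) {v : Fin n} → degree G v ≡ 0 → Universal (complement G) v
isolated⇒universal-complement G {v} isolated w w≢v with w ≟ v
... | yes w≡v = contradiction w≡v w≢v
... | no  _   rewrite adj-sym G w v | count≡0⇒false isolated w = refl

full-degree⇒universal : (G : Graph n) {v : Fin n} → suc (degree G v) ≡ n → Universal G v
full-degree⇒universal G {v} full w w≢v with adj G w v in w∼v
... | true  = refl
... | false = contradiction two-non-neighbours
                            (λ le → <-irrefl refl (subst (_≤ suc (degree G v)) (+-comm (degree G v) 2) le))
  where
  two-non-neighbours : degree G v + 2 ≤ suc (degree G v)
  two-non-neighbours = subst (degree G v + 2 ≤_) (trans (degree-non-neighbours G v) (sym full))
    (+-monoʳ-≤ (degree G v) (count-two (not ∘ adj G v) (cong not (irrefl G v))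
                                         (cong not (trans (adj-sym G v w) w∼v)) (w≢v ∘ sym)))

others : Fin n → Fin n → Fin n → Bool
others u w = (λ _ → true) - u - w

others-comm : (u w i : Fin n) → others u w i ≡ others w u i
others-comm u w i = ∧-comm (not (does (i ≟ u))) (not (does (i ≟ w)))

others-outside : {u w v : Fin n} → others u w v ≡ false → v ≡ u ⊎ v ≡ w
others-outside {u = u} {w} {v} outside with v ≟ u | v ≟ w
... | yes v≡u | _       = inj₁ v≡u
... | no  _   | yes v≡w = inj₂ v≡w
... | no  _   | no  _   with () ← outside

others-u : (u w : Fin n) → others u w u ≡ false
others-u u w rewrite dec-true (u ≟ u) refl = refl

others-w : (u w : Fin n) → others u w w ≡ false
others-w u w = trans (others-comm u w w) (others-u w u)

others-intro : {u w v : Fin n} → v ≢ u → v ≢ w → others u w v ≡ true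
others-intro {u = u} {w} {v} v≢u v≢w = -‿intro ((λ _ → true) - u) (-‿intro (λ _ → true) refl v≢u) v≢w

count-others : {u w : Fin n} → u ≢ w → count (others {n} u w) + 2 ≡ n
count-others {n} {u} {w} u≢w = begin
  count (others u w) + 2
    ≡⟨ +-comm _ 2 ⟩
  suc (suc (count (others u w)))
    ≡⟨ cong suc (count-remove-true ((λ _ → true) - u) {w} (-‿intro (λ _ → true) refl (u≢w ∘ sym))) ⟨
  suc (count ((λ _ → true) - u))
    ≡⟨ count-remove-true (λ _ → true) {u} refl ⟨
  count {n} (λ _ → true)
    ≡⟨ count-true ⟩
  n ∎
  where open ≡-Reasoning

∣others∣ : {u w : Fin n} → u ≢ w → ∣ tabulate (others u w) ∣ ≡ n ∸ 2
∣others∣ {u = u} {w} u≢w = trans (∣tabulate∣≡count (others u w))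
                                  (trans (sym (m+n∸n≡m _ 2)) (cong (_∸ 2) (count-others u≢w)))

neighboursIn-others : (G : Graph n) (u w : Fin n) →
                      neighboursIn G (others u w) u + bit (adj G u w) ≡ degree G u
neighboursIn-others G u w = begin
  neighboursIn G (others u w) u + bit (adj G u w)   ≡⟨ +-comm _ (bit (adj G u w)) ⟩
  bit (adj G u w) + neighboursIn G (others u w) u   ≡⟨ cong (bit (adj G u w) +_) (count-cong drop-u) ⟩
  bit (adj G u w) + count (adj G u - w)             ≡⟨ count-remove (adj G u) w ⟨
  degree G u                                        ∎
  where
  open ≡-Reasoning
  drop-u : ∀ i → adj G u i ∧ others u w i ≡ (adj G u - w) i
  drop-u i with i ≟ u
  ... | yes refl rewrite irrefl G i = refl
  ... | no  _    = refl

-- V ∖ {u, w} is then k-fair in G and (n − 2 − k)-fair in its complement.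
FairPair : Graph n → Fin n → Fin n → Set
FairPair {n} G u w = u ≢ w × Σ[ k ∈ ℕ ] (1 ≤ k × k + 3 ≤ n ×
  degree G u ≡ k + bit (adj G u w) × degree G w ≡ k + bit (adj G u w))

fairPair⇒IsFd≤ : (G : Graph n) {u w : Fin n} {a b : ℕ} → FairPair G u w →
                 IsFd G a → IsFd (complement G) b → a ≤ n ∸ 2 × b ≤ n ∸ 2
fairPair⇒IsFd≤ {n} G {u} {w} (u≢w , k , 1≤k , k+3≤n , deg-u , deg-w) isFdG isFdḠ =
  subst (_ ≤_) ∣D∣≡n∸2 (IsFd-minimal G D isFdG fdG u Du) ,
  subst (_ ≤_) ∣D∣≡n∸2 (IsFd-minimal (complement G) D isFdḠ fdḠ u Du)
  where
  D = tabulate (others u w)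
  ∣D∣≡n∸2 : ∣ D ∣ ≡ n ∸ 2
  ∣D∣≡n∸2 = ∣others∣ u≢w
  Du : lookup D u ≡ false
  Du = trans (lookup∘tabulate _ u) (others-u u w)
  fair : Fair G k (others u w)
  fair v outside with others-outside {u = u} {w} {v} outside
  ... | inj₁ refl = +-cancelʳ-≡ _ _ _ (trans (neighboursIn-others G u w) deg-u)
  ... | inj₂ refl = +-cancelʳ-≡ _ _ _ (begin
    neighboursIn G (others u w) w + bit (adj G u w)
      ≡⟨ cong₂ _+_ (count-cong λ i → cong (adj G w i ∧_) (others-comm u w i)) (cong bit (adj-sym G u w)) ⟩
    neighboursIn G (others w u) w + bit (adj G w u)
      ≡⟨ neighboursIn-others G w u ⟩
    degree G w
      ≡⟨ deg-w ⟩
    k + bit (adj G u w) ∎)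
    where open ≡-Reasoning
  fairD : Fair G k (lookup D)
  fairD = fair-cong G (λ i → sym (lookup∘tabulate _ i)) fair
  fdG : FairDominating G D
  fdG = fair⇒fairDominating G D 1≤k fairD
  fdḠ : FairDominating (complement G) D
  fdḠ = fair⇒fairDominating-complement G D fairD
          (subst (k <_) (sym ∣D∣≡n∸2) (m+n≤o⇒m≤o∸n (suc k) (subst (_≤ n) (+-suc k 2) k+3≤n)))

-- Equal-degree pairs that are not fair pairs: {u, w} is a component K₂ of G or of its complement.
Exceptional : Graph n → Fin n → Fin n → Set
Exceptional {n} G u w = (adj G u w ≡ false × degree G u + 2 ≡ n) ⊎ (adj G u w ≡ true × degree G u ≡ 1)

fairPair-or-exceptional : (G : Graph n) {u w : Fin n} → u ≢ w → degree G u ≡ degree G w →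
  1 ≤ degree G u → degree G u + 2 ≤ n → FairPair G u w ⊎ Exceptional G u w
fairPair-or-exceptional {n} G {u} {w} u≢w same 1≤d d+2≤n with adj G u w in u∼w
... | false with m≤n⇒m<n∨m≡n d+2≤n
...   | inj₁ d+2<n = inj₁ (u≢w , degree G u , 1≤d , subst (_≤ n) (sym (+-suc _ 2)) d+2<n ,
                           sym (+-identityʳ _) , trans (sym same) (sym (+-identityʳ _)))
...   | inj₂ d+2≡n = inj₂ (inj₁ (refl , d+2≡n))
fairPair-or-exceptional {n} G {u} {w} u≢w same 1≤d d+2≤n | true with degree G u
...   | suc zero    = inj₂ (inj₂ (refl , refl))
...   | suc (suc k) = inj₁ (u≢w , suc k , s≤s z≤n , subst (_≤ n) (sym (cong suc (+-suc k 2))) d+2≤n ,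
                            +-comm 1 (suc k) , trans (sym same) (+-comm 1 (suc k)))

d+3≰d+2 : ∀ {d n} → d + 2 ≡ n → ¬ (d + 3 ≤ n)
d+3≰d+2 {d} refl d+3≤d+2 with s≤s (s≤s ()) ← +-cancelˡ-≤ d 3 2 d+3≤d+2

pendant : (G : Graph n) {v j x : Fin n} → degree G v ≡ 1 → adj G v j ≡ true → x ≢ j → adj G v x ≡ false
pendant G {v} {j} {x} deg≡1 v∼j x≢j with adj G v x in v∼x
... | false = refl
... | true  with s≤s () ← subst (2 ≤_) deg≡1 (count-two (adj G v) v∼j v∼x (x≢j ∘ sym))

co-pendant : (G : Graph n) {v j x : Fin n} → degree G v + 2 ≡ n → adj G v j ≡ false →
             j ≢ v → x ≢ v → x ≢ j → adj G v x ≡ true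
co-pendant G {v} {j} {x} deg+2≡n v≁j j≢v x≢v x≢j with adj G v x in v∼x
... | true  = refl
... | false = contradiction (degree+3≤n G v≁j v∼x (j≢v ∘ sym) (x≢v ∘ sym) (x≢j ∘ sym)) (d+3≰d+2 deg+2≡n)

co-pendant-degree : ∀ {n d} → 4 ≤ n → d + 2 ≡ n → Σ[ k ∈ ℕ ] (1 ≤ k × k + 3 ≤ n × d ≡ k + 1)
co-pendant-degree {d = suc (suc k)} _ refl =
  suc k , s≤s z≤n , ≤-reflexive (cong suc (+-suc k 2)) , +-comm 1 (suc k)
co-pendant-degree {d = 0}     (s≤s (s≤s ())) refl
co-pendant-degree {d = 1}     (s≤s (s≤s (s≤s ()))) refl

fairPair-adjacent : (G : Graph n) → 4 ≤ n → {u w : Fin n} → u ≢ w → adj G u w ≡ true →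
                    degree G u + 2 ≡ n → degree G w + 2 ≡ n → FairPair G u w
fairPair-adjacent G 4≤n {u} {w} u≢w u∼w du dw with co-pendant-degree 4≤n du
... | k , 1≤k , k+3≤n , du≡ = u≢w , k , 1≤k , k+3≤n ,
      subst (λ b → degree G u ≡ k + bit b) (sym u∼w) du≡ ,
      subst (λ b → degree G w ≡ k + bit b) (sym u∼w) (trans (+-cancelʳ-≡ 2 _ _ (trans dw (sym du))) du≡)

fairPair-non-adjacent : (G : Graph n) → 4 ≤ n → {u w : Fin n} → u ≢ w → adj G u w ≡ false →
                        degree G u ≡ 1 → degree G w ≡ 1 → FairPair G u w
fairPair-non-adjacent G 4≤n {u} {w} u≢w u≁w du dw =
  u≢w , 1 , ≤-refl , 4≤n ,
  subst (λ b → degree G u ≡ 1 + bit b) (sym u≁w) du , subst (λ b → degree G w ≡ 1 + bit b) (sym u≁w) dw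

two-exceptional⇒fairPair : (G : Graph n) → 4 ≤ n → {i j k l : Fin n} → i ≢ j → k ≢ l → k ≢ i → l ≢ i →
  degree G i ≡ degree G j → Exceptional G i j → Exceptional G k l → ∃[ u ] ∃[ w ] FairPair G u w
two-exceptional⇒fairPair G 4≤n {i} {j} {k} {l} i≢j k≢l k≢i l≢i same eij ekl with k ≟ j | eij | ekl
... | yes refl | inj₁ (i≁k , di) | inj₁ (k≁l , _) =
  contradiction (degree+3≤n G (trans (adj-sym G k i) i≁k) k≁l k≢i k≢l (l≢i ∘ sym))
                (d+3≰d+2 (trans (cong (_+ 2) (sym same)) di))
... | no k≢j | inj₁ (i≁j , di) | inj₁ (_ , dk) =
  i , k , fairPair-adjacent G 4≤n (k≢i ∘ sym) (co-pendant G di i≁j (i≢j ∘ sym) k≢i k≢j) di dk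
... | yes refl | inj₂ (i∼k , _) | inj₂ (k∼l , dk) =
  contradiction (trans (sym (pendant G dk k∼l (l≢i ∘ sym))) (trans (adj-sym G k i) i∼k)) λ ()
... | no k≢j | inj₂ (i∼j , di) | inj₂ (_ , dk) =
  i , k , fairPair-non-adjacent G 4≤n (k≢i ∘ sym) (pendant G di i∼j k≢j) di dk
... | yes refl | inj₁ (_ , di) | inj₂ (_ , dk)
  with s≤s (s≤s (s≤s ())) ← subst (4 ≤_) (sym (trans (sym (cong (_+ 2) (trans same dk))) di)) 4≤n
... | yes refl | inj₂ (_ , di) | inj₁ (_ , dk)
  with s≤s (s≤s (s≤s ())) ← subst (4 ≤_) (sym (trans (sym (cong (_+ 2) (trans (sym same) di))) dk)) 4≤n
... | no k≢j | inj₁ (i≁j , di) | inj₂ (k∼l , dk) =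
  contradiction (trans (sym (pendant G dk k∼l (l≢i ∘ sym)))
                       (trans (adj-sym G k i) (co-pendant G di i≁j (i≢j ∘ sym) k≢i k≢j))) λ ()
... | no k≢j | inj₂ (i∼j , di) | inj₁ (k≁l , dk) =
  contradiction (trans (sym (pendant G di i∼j k≢j))
                       (trans (adj-sym G i k) (co-pendant G dk k≁l (k≢l ∘ sym) (k≢i ∘ sym) (l≢i ∘ sym)))) λ ()

module _ {m : ℕ} (G : Graph (suc (suc m))) (non-isolated : ∀ v → 1 ≤ degree G v)
         (non-full : ∀ v → degree G v + 2 ≤ suc (suc m)) where

  degreeClass : Fin (suc (suc m)) → Fin m
  degreeClass v = fromℕ< (begin-strict
    degree G v ∸ 1   <⟨ ∸-monoʳ-< (s≤s z≤n) (non-isolated v) ⟩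
    degree G v       ≤⟨ +-cancelʳ-≤ 2 _ _ (subst (degree G v + 2 ≤_) (+-comm 2 m) (non-full v)) ⟩
    m                ∎)
    where open ≤-Reasoning

  degreeClass-degree : (u w : Fin (suc (suc m))) → degreeClass u ≡ degreeClass w → degree G u ≡ degree G w
  degreeClass-degree u w same-class = begin
    degree G u                    ≡⟨ m∸n+n≡m (non-isolated u) ⟨
    degree G u ∸ 1 + 1            ≡⟨ cong (_+ 1) (toℕ-fromℕ< _) ⟨
    toℕ (degreeClass u) + 1       ≡⟨ cong (λ c → toℕ c + 1) same-class ⟩
    toℕ (degreeClass w) + 1       ≡⟨ cong (_+ 1) (toℕ-fromℕ< _) ⟩
    degree G w ∸ 1 + 1            ≡⟨ m∸n+n≡m (non-isolated w) ⟩
    degree G w                    ∎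
    where open ≡-Reasoning

  fairPair-exists : 2 ≤ m → ∃[ u ] ∃[ w ] FairPair G u w
  fairPair-exists 2≤m with pigeonhole (m<n⇒m<1+n (n<1+n m)) degreeClass
  ... | i , j , i<j , cij
    with fairPair-or-exceptional G (<⇒≢ᶠ i<j) (degreeClass-degree i j cij) (non-isolated i) (non-full i)
  ...   | inj₁ fair-ij = i , j , fair-ij
  ...   | inj₂ exc-ij with pigeonhole (n<1+n m) (degreeClass ∘ punchIn i)
  ...     | y , z , y<z , cyz with fairPair-or-exceptional G (<⇒≢ᶠ y<z ∘ punchIn-injective i y z)
                                     (degreeClass-degree _ _ cyz) (non-isolated _) (non-full _)
  ...       | inj₁ fair-yz = punchIn i y , punchIn i z , fair-yz
  ...       | inj₂ exc-yz =
    two-exceptional⇒fairPair G (s≤s (s≤s 2≤m)) (<⇒≢ᶠ i<j) (<⇒≢ᶠ y<z ∘ punchIn-injective i y z)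
      (punchInᵢ≢i i y) (punchInᵢ≢i i z) (degreeClass-degree i j cij) exc-ij exc-yz

UpperBound : ℕ → ℕ → ℕ → Set
UpperBound n a b = (a ≤ 1 × b ≤ n) ⊎ (a ≤ n × b ≤ 1) ⊎ (a ≤ n ∸ 2 × b ≤ n ∸ 2)

IsFd-upper : (G : Graph n) {a b : ℕ} → 4 ≤ n → IsFd G a → IsFd (complement G) b → UpperBound n a b
IsFd-upper {suc (suc m)} G (s≤s (s≤s 2≤m)) isFdG isFdḠ
  with any? (λ v → degree G v ℕ.≟ 0) | any? (λ v → suc (degree G v) ℕ.≟ suc (suc m))
... | yes (v , isolated) | _ =
  inj₂ (inj₁ (IsFd-≤n G isFdG ,
              universal⇒IsFd≤1 (complement G) isFdḠ (isolated⇒universal-complement G isolated)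
                (proj₁ (another-vertex v)) (proj₂ (another-vertex v))))
... | no _ | yes (v , full) =
  inj₁ (universal⇒IsFd≤1 G isFdG (full-degree⇒universal G full) (proj₁ (another-vertex v)) (proj₂ (another-vertex v))
        , IsFd-≤n (complement G) isFdḠ)
... | no no-isolated | no no-full =
  inj₂ (inj₂ (fairPair⇒IsFd≤ G (proj₂ (proj₂ (fairPair-exists G non-isolated non-full 2≤m))) isFdG isFdḠ))
  where
  non-isolated : ∀ v → 1 ≤ degree G v
  non-isolated v = n≢0⇒n>0 (λ isolated → no-isolated (v , isolated))
  non-full : ∀ v → degree G v + 2 ≤ suc (suc m)
  non-full v = subst (_≤ suc (suc m)) (+-comm 2 (degree G v))
                     (≤∧≢⇒< (degree<n G v) (λ full → no-full (v , full)))

-- Sharpness of the lower bounds: the star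

universal⇒IsFd-1 : (G : Graph n) {x v : Fin n} → Universal G x → v ≢ x → IsFd G 1
universal⇒IsFd-1 G {x} {v} universal v≢x =
  IsFd-intro G ⁅ x ⁆ (universal⇒fairDominating G universal) (∣⁅x⁆∣≡1 x) v
    (trans (lookup-⁅⁆ x v) (dec-false (v ≟ x) v≢x)) λ D fd → fairDominating-nonempty G D x fd

universal⇒complement-fairDominating-≥2 : (G : Graph n) {x v : Fin n} → Universal G x → v ≢ x →
                                         (D : Subset n) → FairDominating (complement G) D → 2 ≤ ∣ D ∣
universal⇒complement-fairDominating-≥2 G {x} {v} universal v≢x D fd
  with ∣ D ∣ in ∣D∣≡ | fairDominating-nonempty (complement G) D x fd
... | suc (suc _) | _ = s≤s (s≤s z≤n)
... | suc zero    | _ with fairDominating-singleton⇒universal (complement G) D fd ∣D∣≡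
...   | _ , Ḡ-universal = contradiction v≢x (¬universal-both G universal Ḡ-universal v)

star-adj : Fin n → Fin n → Bool
star-adj zero    (suc _) = true
star-adj (suc _) zero    = true
star-adj _       _       = false

star : Graph n
star = record { adj = star-adj ; adj-sym = sym′ ; irrefl = irrefl′ }
  where
  sym′ : ∀ u v → star-adj u v ≡ star-adj v u
  sym′ zero    zero    = refl
  sym′ zero    (suc _) = refl
  sym′ (suc _) zero    = refl
  sym′ (suc _) (suc _) = refl
  irrefl′ : ∀ v → star-adj v v ≡ false
  irrefl′ zero    = refl
  irrefl′ (suc _) = refl

star-universal : Universal (star {suc n}) zero
star-universal zero    0≢0 = contradiction refl 0≢0
star-universal (suc _) _   = refl

IsFd-star : IsFd (star {suc (suc n)}) 1
IsFd-star = universal⇒IsFd-1 star {v = suc zero} star-universal λ ()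

IsFd-complement-star : IsFd (complement (star {suc (suc (suc n))})) 2
IsFd-complement-star {n} =
  IsFd-intro (complement star) centre-and-leaf fd ∣centre-and-leaf∣ (suc (suc zero)) refl
    (universal⇒complement-fairDominating-≥2 star {v = suc zero} star-universal λ ())
  where
  centre-and-leaf : Subset (suc (suc (suc n)))
  centre-and-leaf = true ∷ true ∷ Subset.⊥
  ∣centre-and-leaf∣ : ∣ centre-and-leaf ∣ ≡ 2
  ∣centre-and-leaf∣ = cong (λ k → 2 + k) (∣⊥∣≡0 (suc n))
  fair : Fair star 1 (lookup centre-and-leaf)
  fair (suc (suc _)) _ = cong suc (count-false {n} (λ _ → refl))
  fd : FairDominating (complement star) centre-and-leaf
  fd = fair⇒fairDominating-complement star centre-and-leaf fair
         (subst (1 <_) (sym ∣centre-and-leaf∣) ≤-refl)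

-- Sharpness of the upper bounds

above : (Fin n → Bool) → ℕ → Fin n → Bool
above S x q = S q ∧ does (x ≤? toℕ q)

does-sound : {A : Set} (a? : Dec A) → does a? ≡ true → A
does-sound (yes a) _ = a

above-elim : (S : Fin n → Bool) {x : ℕ} {q : Fin n} → above S x q ≡ true → S q ≡ true × x ≤ toℕ q
above-elim S {x} {q} Sq∧x≤q =
  ∧-conicalˡ _ _ Sq∧x≤q , does-sound (x ≤? toℕ q) (∧-conicalʳ (S q) _ Sq∧x≤q)

above-intro : (S : Fin n → Bool) {x : ℕ} {q : Fin n} → S q ≡ true → x ≤ toℕ q → above S x q ≡ true
above-intro S {x} {q} Sq x≤q rewrite Sq = dec-true (x ≤? toℕ q) x≤q

above-⊑ : (S : Fin n → Bool) {x y : ℕ} → x ≤ y → above S y ⊑ above S x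
above-⊑ S x≤y q Sq∧y≤q with above-elim S Sq∧y≤q
... | Sq , y≤q = above-intro S Sq (≤-trans x≤y y≤q)

above-antitone : (S : Fin n → Bool) {x y : ℕ} → x ≤ y → count (above S y) ≤ count (above S x)
above-antitone S x≤y = count-mono (above-⊑ S x≤y)

above-gap : (S : Fin n → Bool) {x y : ℕ} → x ≤ y → count (above S x) ≤ count (above S y) →
            (q : Fin n) → x ≤ toℕ q → toℕ q < y → S q ≡ false
above-gap S x≤y same q x≤q q<y with S q in Sq
... | false = refl
... | true  = contradiction (proj₂ (above-elim S (count-≤⇒⊒ (above-⊑ S x≤y) same q (above-intro S Sq x≤q))))
                            (<⇒≱ q<y)

-- The vertices are 0, …, m, so n = m + 1, and the constraints on h say that h = ⌊n/2⌋.
module Extremal (m h : ℕ) (3≤m : 3 ≤ m) (h+h≤n : h + h ≤ suc m) (m≤h+h : m ≤ h + h) where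

  2≤h : 2 ≤ h
  2≤h = ≮⇒≥ λ h<2 → <⇒≱ (s≤s (+-mono-≤ (s≤s⁻¹ h<2) (s≤s⁻¹ h<2))) (≤-trans 3≤m m≤h+h)

  h<m : h < m
  h<m = s≤s⁻¹ (subst (_≤ suc m) (+-comm h 2) (≤-trans (+-monoʳ-≤ h 2≤h) h+h≤n))

  vertex : (x : ℕ) → x ≤ m → Fin (suc m)
  vertex x x≤m = fromℕ< (s≤s x≤m)

  toℕ-vertex : (x : ℕ) (x≤m : x ≤ m) → toℕ (vertex x x≤m) ≡ x
  toℕ-vertex x x≤m = toℕ-fromℕ< (s≤s x≤m)

  one mid penultimate top : Fin (suc m)
  one         = vertex 1 (≤-trans (s≤s z≤n) 3≤m)
  mid         = vertex h (<⇒≤ h<m)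
  penultimate = vertex (m ∸ 1) (m∸n≤m m 1)
  top         = vertex m ≤-refl

  adj′ : Fin (suc m) → Fin (suc m) → Bool
  adj′ zero    v       = does (toℕ v ℕ.≟ h)
  adj′ (suc p) zero    = does (toℕ (suc p) ℕ.≟ h)
  adj′ (suc p) (suc q) = not (does (p ≟ q)) ∧ does (suc m ≤? toℕ (suc p) + toℕ (suc q))

  adj′-sym : ∀ u v → adj′ u v ≡ adj′ v u
  adj′-sym zero    zero    = refl
  adj′-sym zero    (suc q) = refl
  adj′-sym (suc p) zero    = refl
  adj′-sym (suc p) (suc q) = cong₂ (λ a b → not a ∧ b) (does-⇔ (mk⇔ sym sym) (p ≟ q) (q ≟ p))
                                                       (cong (λ s → does (suc m ≤? s)) (+-comm (suc (toℕ p)) _))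

  adj′-irrefl : ∀ v → adj′ v v ≡ false
  adj′-irrefl zero    = dec-false (0 ℕ.≟ h) λ 0≡h → contradiction (subst (2 ≤_) (sym 0≡h) 2≤h) λ ()
  adj′-irrefl (suc p) rewrite dec-true (p ≟ p) refl = refl

  extremal : Graph (suc m)
  extremal = record { adj = adj′ ; adj-sym = adj′-sym ; irrefl = adj′-irrefl }

  toℕ-one : toℕ one ≡ 1
  toℕ-one = toℕ-vertex 1 (≤-trans (s≤s z≤n) 3≤m)

  toℕ-mid : toℕ mid ≡ h
  toℕ-mid = toℕ-vertex h (<⇒≤ h<m)

  toℕ-penultimate : toℕ penultimate ≡ m ∸ 1
  toℕ-penultimate = toℕ-vertex (m ∸ 1) (m∸n≤m m 1)

  toℕ-top : toℕ top ≡ m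
  toℕ-top = toℕ-vertex m ≤-refl

  ≢-by-toℕ : {u v : Fin (suc m)} → toℕ u ≢ toℕ v → u ≢ v
  ≢-by-toℕ toℕu≢toℕv = toℕu≢toℕv ∘ cong toℕ

  one≢zero : one ≢ zero
  one≢zero = ≢-by-toℕ λ 1≡0 → contradiction (trans (sym toℕ-one) 1≡0) λ ()

  mid≢zero : mid ≢ zero
  mid≢zero = ≢-by-toℕ λ h≡0 → contradiction (subst (2 ≤_) (trans (sym toℕ-mid) h≡0) 2≤h) λ ()

  penultimate≢zero : penultimate ≢ zero
  penultimate≢zero = ≢-by-toℕ λ m-1≡0 → contradiction (trans (sym toℕ-penultimate) m-1≡0)
                                           (>⇒≢ (∸-monoˡ-≤ 1 (≤-trans (s≤s (s≤s z≤n)) 3≤m)))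

  top≢zero : top ≢ zero
  top≢zero top≡0 = contradiction (trans (sym toℕ-top) (cong toℕ top≡0)) (>⇒≢ (≤-trans (s≤s z≤n) 3≤m))

  mid≢one : mid ≢ one
  mid≢one = ≢-by-toℕ λ h≡1 → <⇒≢ 2≤h (sym (trans (sym toℕ-mid) (trans h≡1 toℕ-one)))

  top≢one : top ≢ one
  top≢one = ≢-by-toℕ λ m≡1 →
    contradiction (subst (3 ≤_) (trans (sym toℕ-top) (trans m≡1 toℕ-one)) 3≤m) λ { (s≤s ()) }

  top≢mid : top ≢ mid
  top≢mid = ≢-by-toℕ λ m≡h → <⇒≢ h<m (sym (trans (sym toℕ-top) (trans m≡h toℕ-mid)))

  top≢penultimate : top ≢ penultimate
  top≢penultimate = ≢-by-toℕ λ m≡m-1 → <⇒≢ (∸-monoʳ-< {m} {1} {0} (s≤s z≤n) (≤-trans (s≤s z≤n) 3≤m))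
                                           (sym (trans (sym toℕ-top) (trans m≡m-1 toℕ-penultimate)))

  toℕ≡h⇒mid : {v : Fin (suc m)} → toℕ v ≡ h → v ≡ mid
  toℕ≡h⇒mid v≡h = toℕ-injective (trans v≡h (sym toℕ-mid))

  top-unique : {q : Fin (suc m)} → m ≤ toℕ q → q ≡ top
  top-unique {q} m≤q = toℕ-injective (trans (≤-antisym (s≤s⁻¹ (toℕ<n q)) m≤q) (sym toℕ-top))

  ≤-toℕ-top : {x : ℕ} → x ≤ m → x ≤ toℕ top
  ≤-toℕ-top x≤m = subst (_ ≤_) (sym toℕ-top) x≤m

  nonzero⇒1≤ : {v : Fin (suc m)} → v ≢ zero → 1 ≤ toℕ v
  nonzero⇒1≤ {zero}  v≢0 = contradiction refl v≢0
  nonzero⇒1≤ {suc _} _   = s≤s z≤n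

  2≤nonzero≢one : {v : Fin (suc m)} → v ≢ zero → v ≢ one → 2 ≤ toℕ v
  2≤nonzero≢one {v} v≢0 v≢1 with m≤n⇒m<n∨m≡n (nonzero⇒1≤ v≢0)
  ... | inj₁ 1<v = 1<v
  ... | inj₂ 1≡v = contradiction (toℕ-injective (trans (sym 1≡v) (sym toℕ-one))) v≢1

  n∸one : suc m ∸ toℕ one ≡ m
  n∸one = cong (suc m ∸_) toℕ-one

  n∸penultimate : suc m ∸ toℕ penultimate ≡ 2
  n∸penultimate = trans (cong (suc m ∸_) toℕ-penultimate) (lemma (≤-trans (s≤s z≤n) 3≤m))
    where
    lemma : ∀ {x} → 1 ≤ x → suc x ∸ (x ∸ 1) ≡ 2
    lemma {suc x} _ = trans (+-∸-assoc 2 (≤-refl {x})) (cong (2 +_) (n∸n≡0 x))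

  n∸top : suc m ∸ toℕ top ≡ 1
  n∸top = trans (cong (suc m ∸_) toℕ-top) (m+n∸n≡m 1 m)

  n∸nonzero≤m : {v : Fin (suc m)} → v ≢ zero → suc m ∸ toℕ v ≤ m
  n∸nonzero≤m {zero}  v≢0 = contradiction refl v≢0
  n∸nonzero≤m {suc p} _   = m∸n≤m m (toℕ p)

  m∸p<h : {p : ℕ} → h < p → m ∸ p < h
  m∸p<h {p} h<p = begin-strict
    m ∸ p              ≤⟨ ∸-monoʳ-≤ m h<p ⟩
    m ∸ suc h          ≤⟨ ∸-monoˡ-≤ (suc h) m≤h+h ⟩
    h + h ∸ suc h      ≡⟨ cong (h + h ∸_) (+-comm 1 h) ⟩
    h + h ∸ (h + 1)    ≡⟨ [m+n]∸[m+o]≡n∸o h h 1 ⟩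
    h ∸ 1              <⟨ ∸-monoʳ-< {h} {1} {0} (s≤s z≤n) (≤-trans (s≤s z≤n) 2≤h) ⟩
    h                  ∎
    where open ≤-Reasoning

  mid-between : {a b : ℕ} → a < b → a + b ≤ suc m → m ≤ a + b → suc m ∸ b ≤ h × h < suc m ∸ a
  mid-between {a} {b} a<b a+b≤n m≤a+b = lower , upper
    where
    lower : suc m ∸ b ≤ h
    lower = m≤n+o⇒m∸n≤o (suc m) b (subst (suc m ≤_) (+-comm h b) (≮⇒≥ λ h+b<n →
      let b≤h = +-cancelˡ-≤ h b h (≤-trans (s≤s⁻¹ h+b<n) m≤h+h)
          h≤a = +-cancelʳ-≤ b h a (≤-trans (s≤s⁻¹ h+b<n) m≤a+b)
      in <⇒≱ a<b (≤-trans b≤h h≤a)))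
    upper : h < suc m ∸ a
    upper = m+n≤o⇒m≤o∸n (suc h) (≰⇒> λ n≤h+a →
      let b≤h = +-cancelˡ-≤ a b h (≤-trans a+b≤n (subst (suc m ≤_) (+-comm h a) n≤h+a))
          h≤a = +-cancelˡ-≤ h h a (≤-trans h+h≤n n≤h+a)
      in <⇒≱ a<b (≤-trans b≤h h≤a))

  above-skip-zero : (S : Fin (suc m) → Bool) {x : ℕ} → 1 ≤ x →
                    count (above S x) ≡ count (above S x ∘ suc)
  above-skip-zero S {x} 1≤x rewrite dec-false (x ≤? 0) (<⇒≱ 1≤x) | ∧-zeroʳ (S zero) = refl

  neighboursIn-zero : (S : Fin (suc m) → Bool) → S zero ≡ false →
                      neighboursIn extremal S zero ≡ bit (S mid)
  neighboursIn-zero S S0 = begin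
    neighboursIn extremal S zero    ≡⟨ count-single _ mid off ⟩
    bit (adj′ zero mid ∧ S mid)     ≡⟨ cong (λ b → bit (b ∧ S mid)) (dec-true (toℕ mid ℕ.≟ h) toℕ-mid) ⟩
    bit (S mid)                     ∎
    where
    open ≡-Reasoning
    off : ∀ v → v ≢ mid → adj′ zero v ∧ S v ≡ false
    off v v≢mid rewrite dec-false (toℕ v ℕ.≟ h) (v≢mid ∘ toℕ≡h⇒mid) = refl

  neighboursIn-nonzero : (S : Fin (suc m) → Bool) {v : Fin (suc m)} → v ≢ zero → S v ≡ false →
    neighboursIn extremal S v ≡ bit (does (toℕ v ℕ.≟ h) ∧ S zero) + count (above S (suc m ∸ toℕ v))
  neighboursIn-nonzero S {zero}  v≢0 _  = contradiction refl v≢0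
  neighboursIn-nonzero S {suc p} _   Sp = cong (bit (does (suc (toℕ p) ℕ.≟ h) ∧ S zero) +_)
    (trans (count-cong threshold) (sym (above-skip-zero S (m<n⇒0<n∸m (toℕ<n p)))))
    where
    sum⇔threshold : ∀ y → suc m ≤ suc (toℕ p) + y ⇔ m ∸ toℕ p ≤ y
    sum⇔threshold y = mk⇔ (λ le → m≤n+o⇒m∸n≤o m (toℕ p) (s≤s⁻¹ le))
                          (λ le → s≤s (≤-trans (m≤n+m∸n m (toℕ p)) (+-monoʳ-≤ (toℕ p) le)))
    threshold : ∀ q → adj′ (suc p) (suc q) ∧ S (suc q) ≡ above S (m ∸ toℕ p) (suc q)
    threshold q with p ≟ q
    ... | yes refl rewrite Sp = refl
    ... | no  _    = trans (∧-comm _ (S (suc q)))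
                           (cong (S (suc q) ∧_) (does-⇔ (sum⇔threshold _) (suc m ≤? _) (m ∸ toℕ p ≤? _)))

  -- With a, b the least and greatest vertices outside S, the window [n − b, n − a) misses S, so it
  -- lies within [a, b]; this forces n − 1 ≤ a + b ≤ n and puts h inside the window.
  equal-above⇒mid-outside : (S : Fin (suc m) → Bool) →
    (∀ {u v} → S u ≡ false → S v ≡ false →
               count (above S (suc m ∸ toℕ u)) ≡ count (above S (suc m ∸ toℕ v))) →
    {p p′ : Fin (suc m)} → p ≢ p′ → S p ≡ false → S p′ ≡ false → S mid ≡ false
  equal-above⇒mid-outside S equal {p} {p′} p≢p′ Sp Sp′
    with extremum ≤-total ≤-trans toℕ (not ∘ S) (cong not Sp)
       | extremum (flip ≤-total) (flip ≤-trans) toℕ (not ∘ S) (cong not Sp)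
  ... | a , Sa , a-least | b , Sb , b-greatest =
    gap mid (subst (_ ≤_) (sym toℕ-mid) (proj₁ mid-window))
            (subst (_< _) (sym toℕ-mid) (proj₂ mid-window))
    where
    a<b : toℕ a < toℕ b
    a<b = ≤∧≢⇒< (a-least b Sb) λ a≡b →
      let squeeze : ∀ {v} → not (S v) ≡ true → toℕ v ≡ toℕ a
          squeeze ¬Sv = ≤-antisym (≤-trans (b-greatest _ ¬Sv) (≤-reflexive (sym a≡b))) (a-least _ ¬Sv)
      in p≢p′ (toℕ-injective (trans (squeeze (cong not Sp)) (sym (squeeze (cong not Sp′)))))
    b≤n : toℕ b ≤ suc m
    b≤n = <⇒≤ (toℕ<n b)
    a≤m : toℕ a ≤ m
    a≤m = s≤s⁻¹ (≤-trans a<b b≤n)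
    gap : ∀ q → suc m ∸ toℕ b ≤ toℕ q → toℕ q < suc m ∸ toℕ a → S q ≡ false
    gap = above-gap S (∸-monoʳ-≤ (suc m) (<⇒≤ a<b))
                      (≤-reflexive (equal (not≡true⇒false Sb) (not≡true⇒false Sa)))
    a≤n∸b : toℕ a ≤ suc m ∸ toℕ b
    a≤n∸b = subst (toℕ a ≤_) toℕ-low (a-least low (cong not (gap low (≤-reflexive (sym toℕ-low))
                                                   (subst (_< _) (sym toℕ-low) (∸-monoʳ-< a<b b≤n)))))
      where
      low : Fin (suc m)
      low = vertex (suc m ∸ toℕ b) (∸-monoʳ-≤ (suc m) (≤-trans (s≤s z≤n) a<b))
      toℕ-low : toℕ low ≡ suc m ∸ toℕ b
      toℕ-low = toℕ-vertex (suc m ∸ toℕ b) (∸-monoʳ-≤ (suc m) (≤-trans (s≤s z≤n) a<b))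
    m∸a≤b : m ∸ toℕ a ≤ toℕ b
    m∸a≤b = subst (_≤ toℕ b) toℕ-high (b-greatest high (cong not (gap high
              (subst (_ ≤_) (sym toℕ-high) (∸-monoʳ-≤ (suc m) a<b))
              (subst (_< suc m ∸ toℕ a) (sym toℕ-high) (≤-reflexive (sym (+-∸-assoc 1 a≤m)))))))
      where
      high : Fin (suc m)
      high = vertex (m ∸ toℕ a) (m∸n≤m m (toℕ a))
      toℕ-high : toℕ high ≡ m ∸ toℕ a
      toℕ-high = toℕ-vertex (m ∸ toℕ a) (m∸n≤m m (toℕ a))
    mid-window : suc m ∸ toℕ b ≤ h × h < suc m ∸ toℕ a
    mid-window = mid-between a<b (subst (toℕ a + toℕ b ≤_) (m∸n+n≡m b≤n) (+-monoˡ-≤ (toℕ b) a≤n∸b))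
                                 (≤-trans (m≤n+m∸n m (toℕ a)) (+-monoʳ-≤ (toℕ a) m∸a≤b))

  module _ (S : Fin (suc m) → Bool) {k : ℕ} (fair : Fair extremal k S) where

    k≡above : {v : Fin (suc m)} → S v ≡ false → v ≢ zero → S zero ≡ false ⊎ v ≢ mid →
              k ≡ count (above S (suc m ∸ toℕ v))
    k≡above {v} Sv v≢0 S0⊎v≢mid =
      trans (sym (fair v Sv)) (trans (neighboursIn-nonzero S v≢0 Sv) (cong (_+ _) (no-mid-edge S0⊎v≢mid)))
      where
      no-mid-edge : S zero ≡ false ⊎ v ≢ mid → bit (does (toℕ v ℕ.≟ h) ∧ S zero) ≡ 0
      no-mid-edge (inj₁ S0)    rewrite S0 = cong bit (∧-zeroʳ _)
      no-mid-edge (inj₂ v≢mid) rewrite dec-false (toℕ v ℕ.≟ h) (v≢mid ∘ toℕ≡h⇒mid) = refl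

    k≡bit-mid : S zero ≡ false → k ≡ bit (S mid)
    k≡bit-mid S0 = trans (sym (fair zero S0)) (neighboursIn-zero S S0)

    outside-zero-mid⇒empty : S zero ≡ false → S mid ≡ false → {p : Fin (suc m)} → p ≢ zero → S p ≡ false →
                             ∀ q → S q ≡ false
    outside-zero-mid⇒empty S0 Smid {p} p≢0 Sp = outside
      where
      nothing-above : ∀ {v} → v ≢ zero → S v ≡ false → count (above S (suc m ∸ toℕ v)) ≡ 0
      nothing-above v≢0 Sv = trans (sym (k≡above Sv v≢0 (inj₁ S0))) (trans (k≡bit-mid S0) (cong bit Smid))
      Stop : S top ≡ false
      Stop with S top in Stop
      ... | false = refl
      ... | true  = contradiction (nothing-above p≢0 Sp) (>⇒≢ (count-pos (above S (suc m ∸ toℕ p))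
                      (above-intro S Stop (≤-toℕ-top (n∸nonzero≤m p≢0)))))
      outside : ∀ q → S q ≡ false
      outside zero    = S0
      outside (suc q) with S (suc q) in Sq
      ... | false = refl
      ... | true  = contradiction (nothing-above top≢zero Stop) (>⇒≢ (count-pos (above S (suc m ∸ toℕ top))
                      (above-intro S Sq (subst (_≤ toℕ (suc q)) (sym n∸top) (s≤s z≤n)))))

    module _ (S0 : S zero ≡ false) (Smid : S mid ≡ true) where

      one-above : ∀ {v} → v ≢ zero → S v ≡ false → count (above S (suc m ∸ toℕ v)) ≡ 1
      one-above v≢0 Sv = trans (sym (k≡above Sv v≢0 (inj₁ S0))) (trans (k≡bit-mid S0) (cong bit Smid))

      ¬two-above : ∀ {v u w} → v ≢ zero → S v ≡ false → S u ≡ true → S w ≡ true → u ≢ w →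
                   suc m ∸ toℕ v ≤ toℕ u → suc m ∸ toℕ v ≤ toℕ w → ⊥
      ¬two-above {v} v≢0 Sv Su Sw u≢w ≤u ≤w with s≤s () ← subst (2 ≤_) (one-above v≢0 Sv)
        (count-two (above S (suc m ∸ toℕ v)) (above-intro S Su ≤u) (above-intro S Sw ≤w) u≢w)

      top-inside : S top ≡ true
      top-inside with S top in Stop | S one in Sone
      ... | true  | _     = refl
      ... | false | true  = ⊥-elim (¬two-above top≢zero Stop Smid Sone mid≢one
                                      (subst (_≤ toℕ mid) (sym n∸top) (subst (1 ≤_) (sym toℕ-mid) (≤-trans (s≤s z≤n) 2≤h)))
                                      (subst (_≤ toℕ one) (sym n∸top) (≤-reflexive (sym toℕ-one))))
      ... | false | false with count-pos⁻¹ (≤-reflexive (sym (one-above one≢zero Sone)))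
      ...   | t , above-t with above-elim S above-t
      ...     | St , n∸1≤t =
        contradiction (trans (trans (sym St) (cong S (top-unique (subst (_≤ toℕ t) n∸one n∸1≤t)))) Stop) λ ()

      penultimate-inside : S penultimate ≡ true
      penultimate-inside with S penultimate in Spen
      ... | true  = refl
      ... | false = ⊥-elim (¬two-above penultimate≢zero Spen top-inside Smid top≢mid
                              (subst (_≤ toℕ top) (sym n∸penultimate) (≤-toℕ-top (≤-trans (s≤s (s≤s z≤n)) 3≤m)))
                              (subst (_≤ toℕ mid) (sym n∸penultimate) (subst (2 ≤_) (sym toℕ-mid) 2≤h)))

      outside⇒one : {q : Fin (suc m)} → q ≢ zero → S q ≡ false → q ≡ one
      outside⇒one {q} q≢0 Sq with q ≟ one
      ... | yes q≡1 = q≡1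
      ... | no  q≢1 = ⊥-elim (¬two-above q≢0 Sq top-inside penultimate-inside top≢penultimate
          (≤-toℕ-top (n∸nonzero≤m q≢0))
          (subst (suc m ∸ toℕ q ≤_) (sym toℕ-penultimate) (∸-monoʳ-≤ (suc m) (2≤nonzero≢one q≢0 q≢1))))

    module _ (S0 : S zero ≡ true) (Smid : S mid ≡ false) where

      nonzero : ∀ {v} → S v ≡ false → v ≢ zero
      nonzero Sv refl = contradiction (trans (sym S0) Sv) λ ()

      k≡suc-above-mid : k ≡ suc (count (above S (suc m ∸ h)))
      k≡suc-above-mid = begin
        k
          ≡⟨ fair mid Smid ⟨
        neighboursIn extremal S mid
          ≡⟨ neighboursIn-nonzero S (nonzero Smid) Smid ⟩
        bit (does (toℕ mid ℕ.≟ h) ∧ S zero) + count (above S (suc m ∸ toℕ mid))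
          ≡⟨ cong₂ (λ b x → bit (b ∧ S zero) + count (above S (suc m ∸ x)))
                   (dec-true (toℕ mid ℕ.≟ h) toℕ-mid) toℕ-mid ⟩
        bit (S zero) + count (above S (suc m ∸ h))
          ≡⟨ cong (λ b → bit b + count (above S (suc m ∸ h))) S0 ⟩
        suc (count (above S (suc m ∸ h))) ∎
        where open ≡-Reasoning

      beyond-mid : ∀ {v} → S v ≡ false → v ≢ mid → h < toℕ v
      beyond-mid {v} Sv v≢mid = ≰⇒> λ v≤h → <-irrefl refl (begin-strict
        k                                         ≡⟨ k≡above Sv (nonzero Sv) (inj₂ v≢mid) ⟩
        count (above S (suc m ∸ toℕ v))           ≤⟨ above-antitone S (∸-monoʳ-≤ (suc m) v≤h) ⟩
        count (above S (suc m ∸ h))               <⟨ n<1+n _ ⟩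
        suc (count (above S (suc m ∸ h)))         ≡⟨ k≡suc-above-mid ⟨
        k                                         ∎)
        where open ≤-Reasoning

      -- Outside vertices p < p′ lie beyond h; their equal counts force m − p ∈ [n − p′, n − p) out of S,
      -- although m − p < h.
      outside-mid-inside-zero : {p p′ : Fin (suc m)} → toℕ p < toℕ p′ →
                                p ≢ mid → p′ ≢ mid → S p ≡ false → S p′ ≡ false → ⊥
      outside-mid-inside-zero {p} {p′} p<p′ p≢mid p′≢mid Sp Sp′ =
        <-asym (beyond-mid Sq (≢-by-toℕ λ q≡mid → <⇒≢ q<h (trans q≡mid toℕ-mid))) q<h
        where
        P≤m : toℕ p ≤ m
        P≤m = s≤s⁻¹ (≤-trans (s≤s (<⇒≤ p<p′)) (toℕ<n p′))
        q : Fin (suc m)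
        q = vertex (m ∸ toℕ p) (m∸n≤m m (toℕ p))
        toℕ-q : toℕ q ≡ m ∸ toℕ p
        toℕ-q = toℕ-vertex (m ∸ toℕ p) (m∸n≤m m (toℕ p))
        q<h : toℕ q < h
        q<h = subst (_< h) (sym toℕ-q) (m∸p<h (beyond-mid Sp p≢mid))
        Sq : S q ≡ false
        Sq = above-gap S (∸-monoʳ-≤ (suc m) (<⇒≤ p<p′))
               (≤-reflexive (trans (sym (k≡above Sp′ (nonzero Sp′) (inj₂ p′≢mid)))
                                   (k≡above Sp (nonzero Sp) (inj₂ p≢mid))))
               q (subst (suc m ∸ toℕ p′ ≤_) (sym toℕ-q) (∸-monoʳ-≤ (suc m) p<p′))
                 (subst (_< suc m ∸ toℕ p) (sym toℕ-q) (≤-reflexive (sym (+-∸-assoc 1 P≤m))))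

    inside-zero-mid : S zero ≡ true → S mid ≡ true → {p p′ : Fin (suc m)} → p ≢ p′ →
                      S p ≡ false → S p′ ≡ false → ⊥
    inside-zero-mid S0 Smid p≢p′ Sp Sp′ =
      contradiction (trans (sym Smid) (equal-above⇒mid-outside S equal p≢p′ Sp Sp′)) λ ()
      where
      equal : ∀ {u v} → S u ≡ false → S v ≡ false →
              count (above S (suc m ∸ toℕ u)) ≡ count (above S (suc m ∸ toℕ v))
      equal Su Sv = trans (sym (k≡above′ Su)) (k≡above′ Sv)
        where
        k≡above′ : ∀ {v} → S v ≡ false → k ≡ count (above S (suc m ∸ toℕ v))
        k≡above′ Sv = k≡above Sv (λ { refl → contradiction (trans (sym S0) Sv) λ () })
                                 (inj₂ λ { refl → contradiction (trans (sym Smid) Sv) λ () })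

    fair-set-large : 0 < count S → suc m ≤ count S + 2
    fair-set-large 0<∣S∣ = ≮⇒≥ (λ small → small⇒⊥ (three-outside small))
      where
      three-outside : count S + 2 < suc m → 3 ≤ count (not ∘ S)
      three-outside small = +-cancelˡ-≤ (count S) 3 _
        (subst (count S + 3 ≤_) (sym (count-not S)) (subst (_≤ suc m) (sym (+-suc (count S) 2)) small))
      small⇒⊥ : 3 ≤ count (not ∘ S) → ⊥
      small⇒⊥ 3≤ with count-two-avoiding zero 3≤ | count-two-avoiding mid 3≤ | S zero in S0 | S mid in Smid
      ... | p , _ , _ , p≢0 , _ , ¬Sp , _ | _ | false | false =
        contradiction (count-false (outside-zero-mid⇒empty S0 Smid p≢0 (not≡true⇒false ¬Sp))) (>⇒≢ 0<∣S∣)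
      ... | p , p′ , p≢p′ , p≢0 , p′≢0 , ¬Sp , ¬Sp′ | _ | false | true =
        p≢p′ (trans (outside⇒one S0 Smid p≢0 (not≡true⇒false ¬Sp))
                    (sym (outside⇒one S0 Smid p′≢0 (not≡true⇒false ¬Sp′))))
      ... | p , p′ , p≢p′ , _ , _ , ¬Sp , ¬Sp′ | _ | true | true =
        inside-zero-mid S0 Smid p≢p′ (not≡true⇒false ¬Sp) (not≡true⇒false ¬Sp′)
      ... | _ | p , p′ , p≢p′ , p≢mid , p′≢mid , ¬Sp , ¬Sp′ | true | false with <-cmp (toℕ p) (toℕ p′)
      ...   | tri< p<p′ _ _ =
        outside-mid-inside-zero S0 Smid p<p′ p≢mid p′≢mid (not≡true⇒false ¬Sp) (not≡true⇒false ¬Sp′)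
      ...   | tri≈ _ p≡p′ _ = p≢p′ (toℕ-injective p≡p′)
      ...   | tri> _ _ p′<p =
        outside-mid-inside-zero S0 Smid p′<p p′≢mid p≢mid (not≡true⇒false ¬Sp′) (not≡true⇒false ¬Sp)

  fair⇒large : {k : ℕ} (D : Subset (suc m)) → Fair extremal k (lookup D) → 1 ≤ ∣ D ∣ → suc m ∸ 2 ≤ ∣ D ∣
  fair⇒large D fair 1≤∣D∣ = m≤n+o⇒m∸n≤o (suc m) 2
    (subst (suc m ≤_) (trans (+-comm _ 2) (cong (2 +_) (sym (∣D∣≡count D))))
           (fair-set-large (lookup D) fair (subst (1 ≤_) (∣D∣≡count D) 1≤∣D∣)))

  D₀ : Subset (suc m)
  D₀ = tabulate (others zero one)

  D₀-zero : lookup D₀ zero ≡ false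
  D₀-zero = trans (lookup∘tabulate (others zero one) zero) (others-u zero one)

  ∣D₀∣ : ∣ D₀ ∣ ≡ suc m ∸ 2
  ∣D₀∣ = ∣others∣ (one≢zero ∘ sym)

  fair₀ : Fair extremal 1 (others zero one)
  fair₀ v outside with others-outside {u = zero} {one} {v} outside
  ... | inj₁ refl = trans (neighboursIn-zero (others zero one) (others-u zero one))
                          (cong bit (others-intro mid≢zero mid≢one))
  ... | inj₂ refl = begin
    neighboursIn extremal (others zero one) one
      ≡⟨ neighboursIn-nonzero (others zero one) one≢zero (others-w zero one) ⟩
    bit (does (toℕ one ℕ.≟ h) ∧ others zero one zero) + count (above (others zero one) (suc m ∸ toℕ one))
      ≡⟨ cong₂ (λ b x → bit b + count (above (others zero one) x))
               (trans (cong (does (toℕ one ℕ.≟ h) ∧_) (others-u zero one)) (∧-zeroʳ _)) n∸one ⟩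
    count (above (others zero one) m)
      ≡⟨ count-single (above (others zero one) m) top only-top ⟩
    bit (above (others zero one) m top)
      ≡⟨ cong bit (above-intro (others zero one) (others-intro top≢zero top≢one) (≤-reflexive (sym toℕ-top))) ⟩
    1 ∎
    where
    open ≡-Reasoning
    only-top : ∀ q → q ≢ top → above (others zero one) m q ≡ false
    only-top q q≢top with above (others zero one) m q in above-q
    ... | false = refl
    ... | true  = contradiction (top-unique (proj₂ (above-elim (others zero one) above-q))) q≢top

  fair₀-D₀ : Fair extremal 1 (lookup D₀)
  fair₀-D₀ = fair-cong extremal (λ i → sym (lookup∘tabulate (others zero one) i)) fair₀

  IsFd-extremal : IsFd extremal (suc m ∸ 2)
  IsFd-extremal = IsFd-intro extremal D₀ (fair⇒fairDominating extremal D₀ ≤-refl fair₀-D₀) ∣D₀∣ zero D₀-zero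
    λ D fd → fair⇒large D (proj₂ (proj₂ (fairDominating⇒fair extremal D fd)))
                          (fairDominating-nonempty extremal D zero fd)

  IsFd-extremal-complement : IsFd (complement extremal) (suc m ∸ 2)
  IsFd-extremal-complement = IsFd-intro (complement extremal) D₀
    (fair⇒fairDominating-complement extremal D₀ fair₀-D₀ (subst (1 <_) (sym ∣D₀∣) (∸-monoˡ-≤ 2 (s≤s 3≤m))))
    ∣D₀∣ zero D₀-zero
    λ D fd → fair⇒large D
               (fair-complement⁻¹ extremal (proj₂ (proj₂ (fairDominating⇒fair (complement extremal) D fd))))
                          (fairDominating-nonempty (complement extremal) D zero fd)


halve : ∀ n → Σ[ h ∈ ℕ ] (h + h ≤ n × n ≤ suc (h + h))
halve 0 = 0 , z≤n , z≤n
halve 1 = 0 , z≤n , ≤-refl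
halve (suc (suc n)) with halve n
... | h , h+h≤n , n≤2h+1 = suc h , subst (_≤ suc (suc n)) (cong suc (sym (+-suc h h))) (s≤s (s≤s h+h≤n)) ,
                           subst (suc (suc n) ≤_) (cong (λ k → 2 + k) (sym (+-suc h h))) (s≤s (s≤s n≤2h+1))

star-witness : ∀ n → 3 ≤ n → Σ[ G ∈ Graph n ] (IsFd G 1 × IsFd (complement G) 2)
star-witness (suc (suc (suc _))) (s≤s (s≤s (s≤s z≤n))) = star , IsFd-star , IsFd-complement-star

extremal-witness : ∀ n → 4 ≤ n → Σ[ G ∈ Graph n ] (IsFd G (n ∸ 2) × IsFd (complement G) (n ∸ 2))
extremal-witness (suc m) (s≤s 3≤m) with halve (suc m)
... | h , h+h≤n , n≤2h+1 = extremal , IsFd-extremal , IsFd-extremal-complement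
  where open Extremal m h 3≤m h+h≤n (s≤s⁻¹ n≤2h+1)

sum-lower : {a b : ℕ} → 1 ≤ a × 1 ≤ b × (2 ≤ a ⊎ 2 ≤ b) → 3 ≤ a + b
sum-lower (_   , 1≤b , inj₁ 2≤a) = +-mono-≤ 2≤a 1≤b
sum-lower (1≤a , _   , inj₂ 2≤b) = +-mono-≤ 1≤a 2≤b

product-lower : {a b : ℕ} → 1 ≤ a × 1 ≤ b × (2 ≤ a ⊎ 2 ≤ b) → 2 ≤ a * b
product-lower (_   , 1≤b , inj₁ 2≤a) = *-mono-≤ 2≤a 1≤b
product-lower (1≤a , _   , inj₂ 2≤b) = *-mono-≤ 1≤a 2≤b

[n∸2]+[n∸2]≡2n∸4 : ∀ n → (n ∸ 2) + (n ∸ 2) ≡ 2 * n ∸ 4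
[n∸2]+[n∸2]≡2n∸4 n = trans (cong ((n ∸ 2) +_) (sym (+-identityʳ (n ∸ 2)))) (*-distribˡ-∸ 2 n 2)

1+n≤[n∸2]+[n∸2] : 5 ≤ n → 1 + n ≤ (n ∸ 2) + (n ∸ 2)
1+n≤[n∸2]+[n∸2] {suc (suc k)} (s≤s (s≤s 3≤k)) = subst (_≤ k + k) (+-comm k 3) (+-monoʳ-≤ k 3≤k)

n≤[n∸2]*[n∸2] : 4 ≤ n → n ≤ (n ∸ 2) * (n ∸ 2)
n≤[n∸2]*[n∸2] {suc (suc k)} (s≤s (s≤s 2≤k)) = begin
  2 + k      ≡⟨ +-comm 2 k ⟩
  k + 2      ≤⟨ +-monoʳ-≤ k 2≤k ⟩
  k + k      ≡⟨ cong (k +_) (+-identityʳ k) ⟨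
  2 * k      ≤⟨ *-monoˡ-≤ k 2≤k ⟩
  k * k      ∎
  where open ≤-Reasoning

sum-upper : {a b : ℕ} → 5 ≤ n → UpperBound n a b → a + b ≤ 2 * n ∸ 4
sum-upper {n} {a} {b} 5≤n bounds = subst (a + b ≤_) ([n∸2]+[n∸2]≡2n∸4 n) (case bounds)
  where
  1+n≤ : 1 + n ≤ (n ∸ 2) + (n ∸ 2)
  1+n≤ = 1+n≤[n∸2]+[n∸2] 5≤n
  case : UpperBound n a b → a + b ≤ (n ∸ 2) + (n ∸ 2)
  case (inj₁ (a≤1 , b≤n))        = ≤-trans (+-mono-≤ a≤1 b≤n) 1+n≤
  case (inj₂ (inj₁ (a≤n , b≤1))) = ≤-trans (+-mono-≤ a≤n b≤1) (subst (_≤ (n ∸ 2) + (n ∸ 2)) (+-comm 1 n) 1+n≤)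
  case (inj₂ (inj₂ (a≤ , b≤)))   = +-mono-≤ a≤ b≤

product-upper : {a b : ℕ} → 4 ≤ n → UpperBound n a b → a * b ≤ (n ∸ 2) * (n ∸ 2)
product-upper {n} 4≤n (inj₁ (a≤1 , b≤n))        =
  ≤-trans (*-mono-≤ a≤1 b≤n) (subst (_≤ (n ∸ 2) * (n ∸ 2)) (sym (+-identityʳ n)) (n≤[n∸2]*[n∸2] 4≤n))
product-upper {n} 4≤n (inj₂ (inj₁ (a≤n , b≤1))) =
  ≤-trans (*-mono-≤ a≤n b≤1) (subst (_≤ (n ∸ 2) * (n ∸ 2)) (sym (*-identityʳ n)) (n≤[n∸2]*[n∸2] 4≤n))
product-upper {n} 4≤n (inj₂ (inj₂ (a≤ , b≤)))   = *-mono-≤ a≤ b≤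

theorem6 : ((n : ℕ) → 5 ≤ n →
    ((G : Graph n) (a b : ℕ) → IsFd G a → IsFd (complement G) b →
    3 ≤ a + b × a + b ≤ 2 * n ∸ 4)
    × (Σ[ G ∈ Graph n ] ∃[ a ] ∃[ b ] (IsFd G a × IsFd (complement G) b × a + b ≡ 3))
    × (Σ[ G ∈ Graph n ] ∃[ a ] ∃[ b ] (IsFd G a × IsFd (complement G) b × a + b ≡ 2 * n ∸ 4)))
    ×
    ((n : ℕ) → 4 ≤ n →
    ((G : Graph n) (a b : ℕ) → IsFd G a → IsFd (complement G) b →
    2 ≤ a * b × a * b ≤ (n ∸ 2) * (n ∸ 2))
    × (Σ[ G ∈ Graph n ] ∃[ a ] ∃[ b ] (IsFd G a × IsFd (complement G) b × a * b ≡ 2))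
    × (Σ[ G ∈ Graph n ] ∃[ a ] ∃[ b ] (IsFd G a × IsFd (complement G) b × a * b ≡ (n ∸ 2) * (n ∸ 2))))
theorem6 =
  (λ n 5≤n →
    (λ G a b fdG fdḠ → sum-lower (IsFd-lower G (≤-trans (m≤m+n 2 3) 5≤n) fdG fdḠ) ,
                       sum-upper 5≤n (IsFd-upper G (≤-trans (m≤m+n 4 1) 5≤n) fdG fdḠ)) ,
    (let G , fdG , fdḠ = star-witness n (≤-trans (m≤m+n 3 2) 5≤n) in G , 1 , 2 , fdG , fdḠ , refl) ,
    (let G , fdG , fdḠ = extremal-witness n (≤-trans (m≤m+n 4 1) 5≤n) in
       G , n ∸ 2 , n ∸ 2 , fdG , fdḠ , [n∸2]+[n∸2]≡2n∸4 n)) ,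
  (λ n 4≤n →
    (λ G a b fdG fdḠ → product-lower (IsFd-lower G (≤-trans (m≤m+n 2 2) 4≤n) fdG fdḠ) ,
                       product-upper 4≤n (IsFd-upper G 4≤n fdG fdḠ)) ,
    (let G , fdG , fdḠ = star-witness n (≤-trans (m≤m+n 3 1) 4≤n) in G , 1 , 2 , fdG , fdḠ , refl) ,
    (let G , fdG , fdḠ = extremal-witness n 4≤n in G , n ∸ 2 , n ∸ 2 , fdG , fdḠ , refl))
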